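{- Let $\ell>6$ and $k>2$ be integers and $t>0$ real, and consider the graph $H_{\ell,k,t}$. Then the equivalence classes of $\sim_u$ are $\{u_a\}_a$, $\{u\}$, $\{x_{1,a}\}_a,\dots,\{x_{\ell,a}\}_a$, $\{y_{1,a}\}_a$, $\{y_{2,*}\}$, $\{y_{3,*}\}$, $\{y_{4,a}\}_a$, $\{v\}$, $\{v_a\}_a$.
   Context: $B_{\ell,k}$: for each $1\le a\le k$ take disjoint paths $x_{0,a}x_{1,a}\cdots x_{\ell+1,a}$ and $y_{0,a}y_{1,a}y_{2,a}y_{3,a}y_{4,a}y_{5,a}$; identify all $x_{0,a},y_{0,a}$ into one vertex $u$, all $x_{\ell+1,a},y_{5,a}$ into one vertex $v$, all $y_{2,a}$ into one vertex $y_{2,*}$ and all $y_{3,a}$ into one vertex $y_{3,*}$ (so the edges $y_{2,a}y_{3,a}$ become the single edge $y_{2,*}y_{3,*}$). With $T=\lfloor tk\rfloor$, $H_{\ell,k,t}$ is obtained from $B_{\ell,k}$ by adding pendant vertices $u_1,\dots,u_T$ adjacent to $u$ and $v_1,\dots,v_T$ adjacent to $v$. For vertices $y,z$, $y\sim_u z$ means there is a graph automorphism $\pi$ with $\pi(u)=u$ and $\pi(y)=z$. -}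

module Defs where

open import Data.Nat using (ℕ; suc)
open import Data.Fin using (Fin; toℕ)
open import Data.Product using (Σ; _×_; proj₁)
open import Data.Sum using (_⊎_)
open import Relation.Binary.PropositionalEquality using (_≡_)
open import Function.Bundles using (_↔_; _⇔_; Inverse)

-- Vertices of H_{ℓ,k,T} (T = ⌊t k⌋ = number of pendant vertices at u and at v).
-- Indexing: x i a (i : Fin ℓ, a : Fin k) is x_{i+1,a+1}; x_{0,a}=u, x_{ℓ+1,a}=v.
-- y1 a, y4 a are y_{1,a+1}, y_{4,a+1}; y2* , y3* are the identified vertices;
-- pu b, pv b are the pendants u_{b+1}, v_{b+1}.
data V (ℓ k T : ℕ) : Set where
  u v y2* y3* : V ℓ k T
  x : Fin ℓ → Fin k → V ℓ k T
  y1 y4 : Fin k → V ℓ k T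
  pu pv : Fin T → V ℓ k T

data E {ℓ k T : ℕ} : V ℓ k T → V ℓ k T → Set where
  u-x   : (i : Fin ℓ) (a : Fin k) → toℕ i ≡ 0 → E u (x i a)
  x-x   : (i j : Fin ℓ) (a : Fin k) → toℕ j ≡ suc (toℕ i) → E (x i a) (x j a)
  x-v   : (i : Fin ℓ) (a : Fin k) → suc (toℕ i) ≡ ℓ → E (x i a) v
  u-y1  : (a : Fin k) → E u (y1 a)
  y1-y2 : (a : Fin k) → E (y1 a) y2*
  y2-y3 : E y2* y3*
  y3-y4 : (a : Fin k) → E y3* (y4 a)
  y4-v  : (a : Fin k) → E (y4 a) v
  u-pu  : (b : Fin T) → E u (pu b)
  v-pv  : (b : Fin T) → E v (pv b)

Adj : {ℓ k T : ℕ} → V ℓ k T → V ℓ k T → Set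
Adj y z = E y z ⊎ E z y

Automorphism : (ℓ k T : ℕ) → Set
Automorphism ℓ k T =
  Σ (V ℓ k T ↔ V ℓ k T) λ π →
    ∀ y z → Adj y z ⇔ Adj (Inverse.to π y) (Inverse.to π z)

Sim-u : (ℓ k T : ℕ) → V ℓ k T → V ℓ k T → Set
Sim-u ℓ k T y z =
  Σ (Automorphism ℓ k T) λ π →
    (Inverse.to (proj₁ π) u ≡ u) × (Inverse.to (proj₁ π) y ≡ z)

data ClassLabel (ℓ : ℕ) : Set where
  Cpu Cu Cy1 Cy2 Cy3 Cy4 Cv Cpv : ClassLabel ℓ
  Cx : Fin ℓ → ClassLabel ℓ

cls : {ℓ k T : ℕ} → V ℓ k T → ClassLabel ℓ
cls u = Cu
cls v = Cv
cls y2* = Cy2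
cls y3* = Cy3
cls (x i a) = Cx i
cls (y1 a) = Cy1
cls (y4 a) = Cy4
cls (pu b) = Cpu
cls (pv b) = Cpv

{-# OPTIONS --safe #-}
-- An automorphism fixing u must fix y₂*: it is the only vertex other than u
-- joined to u by two distinct paths of length two (this needs ℓ ≥ 2 and k ≥ 2).
-- Then y₃* and v are fixed and the classes {y₁,ₐ} and {y₄,ₐ} are preserved.
-- Walking along the x-paths away from u, the image of x_{i+1,a} is a neighbour of
-- some x_{i,a'}; it is neither u nor v (both fixed), and not x_{i-1,a'}, since the
-- inverse automorphism preserves the earlier levels. The pendants at u and v have
-- nowhere else to go. Conversely, permuting the k path indices, or the pendant
-- indices, gives automorphisms fixing u that move any vertex within its class.
module Submission where

open import Defs
open import Data.Nat using (ℕ; suc; _<_; s≤s; z≤n)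
open import Data.Nat.Properties using (≤-reflexive; <-irrefl; <-trans; <-asym)
open import Data.Fin as Fin using (Fin; toℕ; fromℕ<; inject₁)
open import Data.Fin.Properties using (toℕ-injective; toℕ-fromℕ<; toℕ-inject₁)
open import Data.Fin.Induction using (<-wellFounded)
open import Data.Fin.Permutation using (Permutation′; _⟨$⟩ʳ_; inverseˡ; flip; id; transpose)
open import Data.Product using (Σ; _×_; _,_; proj₁)
open import Data.Sum using (_⊎_; inj₁; inj₂)
open import Data.Empty using (⊥-elim)
open import Function.Bundles using (_⇔_; Inverse; Equivalence; mk⇔; mk↔ₛ′)
open import Induction.WellFounded using (module All)
open import Relation.Binary.PropositionalEquality using (_≡_; _≢_; refl; sym; trans; cong; subst; subst₂; module ≡-Reasoning)
open import Relation.Nullary.Decidable using (dec-true)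

zero-or-successor : ∀ {n} (i : Fin n) → toℕ i ≡ 0 ⊎ Σ (Fin n) λ i₀ → toℕ i ≡ suc (toℕ i₀)
zero-or-successor Fin.zero    = inj₁ refl
zero-or-successor (Fin.suc i) = inj₂ (inject₁ i , cong suc (sym (toℕ-inject₁ i)))

successor⇒> : ∀ {n} {i j : Fin n} → toℕ i ≡ suc (toℕ j) → j Fin.< i
successor⇒> e = ≤-reflexive (sym e)

transpose-sends : ∀ {n} (a b : Fin n) → transpose a b ⟨$⟩ʳ a ≡ b
transpose-sends a b rewrite dec-true (a Fin.≟ a) refl = refl

-- Adjacency preservation is required of both directions, so that inverting is swapping fields.

record Aut-u (ℓ k T : ℕ) : Set where
  field
    to from  : V ℓ k T → V ℓ k T
    from∘to  : ∀ y → from (to y) ≡ y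
    to∘from  : ∀ y → to (from y) ≡ y
    to-adj   : ∀ {y z} → Adj y z → Adj (to y) (to z)
    from-adj : ∀ {y z} → Adj y z → Adj (from y) (from z)
    to-u     : to u ≡ u

open Aut-u

module _ {ℓ k T : ℕ} where

  data TwoStepsFromU : V ℓ k T → V ℓ k T → Set where
    back    : ∀ {w} → TwoStepsFromU w u
    via-y₁  : ∀ a → TwoStepsFromU (y1 a) y2*
    along-x : ∀ {i j} a → toℕ i ≡ 0 → TwoStepsFromU (x i a) (x j a)

  two-steps-from-u : 1 < ℓ → ∀ {w z : V ℓ k T} → Adj u w → Adj w z → TwoStepsFromU w z
  two-steps-from-u _   (inj₁ (u-x i a i≡0)) (inj₁ (x-x .i j .a _))  = along-x a i≡0
  two-steps-from-u 1<ℓ (inj₁ (u-x i a i≡0)) (inj₁ (x-v .i .a i+1≡ℓ)) =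
    ⊥-elim (<-irrefl refl (subst (1 <_) (sym (trans (cong suc (sym i≡0)) i+1≡ℓ)) 1<ℓ))
  two-steps-from-u _   (inj₁ (u-x i a _))   (inj₂ (u-x .i .a _))    = back
  two-steps-from-u _   (inj₁ (u-x i a i≡0)) (inj₂ (x-x j .i .a i≡j+1))
    with () ← trans (sym i≡0) i≡j+1
  two-steps-from-u _   (inj₁ (u-y1 a))      (inj₁ (y1-y2 .a))        = via-y₁ a
  two-steps-from-u _   (inj₁ (u-y1 a))      (inj₂ (u-y1 .a))         = back
  two-steps-from-u _   (inj₁ (u-pu b))      (inj₂ (u-pu .b))         = back

  TwoCommonNeighbours : V ℓ k T → V ℓ k T → Set
  TwoCommonNeighbours p q =
    Σ (V ℓ k T) λ w₁ → Σ (V ℓ k T) λ w₂ →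
      w₁ ≢ w₂ × Adj p w₁ × Adj w₁ q × Adj p w₂ × Adj w₂ q

  two-common-neighbours-with-u : 1 < ℓ → ∀ {z} → TwoCommonNeighbours u z → z ≡ u ⊎ z ≡ y2*
  two-common-neighbours-with-u 1<ℓ (w₁ , w₂ , w₁≢w₂ , uw₁ , w₁z , uw₂ , w₂z)
    with two-steps-from-u 1<ℓ uw₁ w₁z | two-steps-from-u 1<ℓ uw₂ w₂z
  ... | back       | _           = inj₁ refl
  ... | via-y₁ _   | _           = inj₂ refl
  ... | along-x a p | along-x .a q =
    ⊥-elim (w₁≢w₂ (cong (λ i → x i a) (toℕ-injective (trans p (sym q)))))

  data NeighbourOfU (w : V ℓ k T) : Set where
    pendant : cls w ≡ Cpu → NeighbourOfU w
    first-x : ∀ {j} → toℕ j ≡ 0 → cls w ≡ Cx j → NeighbourOfU w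
    first-y : cls w ≡ Cy1 → NeighbourOfU w

  neighbour-of-u : ∀ {w : V ℓ k T} → Adj u w → NeighbourOfU w
  neighbour-of-u (inj₁ (u-x i a i≡0)) = first-x i≡0 refl
  neighbour-of-u (inj₁ (u-y1 a))      = first-y refl
  neighbour-of-u (inj₁ (u-pu b))      = pendant refl

  data NeighbourOfV (w : V ℓ k T) : Set where
    pendant : cls w ≡ Cpv → NeighbourOfV w
    last-x  : ∀ {j} → cls w ≡ Cx j → NeighbourOfV w
    last-y  : cls w ≡ Cy4 → NeighbourOfV w

  neighbour-of-v : ∀ {w : V ℓ k T} → Adj v w → NeighbourOfV w
  neighbour-of-v (inj₁ (v-pv b))     = pendant refl
  neighbour-of-v (inj₂ (x-v i a _))  = last-x refl
  neighbour-of-v (inj₂ (y4-v a))     = last-y refl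

  data NeighbourOfX (i : Fin ℓ) (z : V ℓ k T) : Set where
    next : ∀ {j} → toℕ j ≡ suc (toℕ i) → cls z ≡ Cx j → NeighbourOfX i z
    prev : ∀ {j} → toℕ i ≡ suc (toℕ j) → cls z ≡ Cx j → NeighbourOfX i z
    is-u : z ≡ u → NeighbourOfX i z
    is-v : z ≡ v → NeighbourOfX i z

  neighbour-of-x : ∀ {i} {w z : V ℓ k T} → cls w ≡ Cx i → Adj w z → NeighbourOfX i z
  neighbour-of-x {w = x i a} refl (inj₁ (x-x .i j .a j≡i+1)) = next j≡i+1 refl
  neighbour-of-x {w = x i a} refl (inj₁ (x-v .i .a _))       = is-v refl
  neighbour-of-x {w = x i a} refl (inj₂ (u-x .i .a _))       = is-u refl
  neighbour-of-x {w = x i a} refl (inj₂ (x-x j .i .a i≡j+1)) = prev i≡j+1 refl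

  neighbour-of-pendant : ∀ {w z : V ℓ k T} → cls w ≡ Cpu → Adj w z → z ≡ u
  neighbour-of-pendant {w = pu b} refl (inj₂ (u-pu .b)) = refl

  common-neighbour-of-u-y₂ : ∀ {w : V ℓ k T} → Adj u w → Adj y2* w → cls w ≡ Cy1
  common-neighbour-of-u-y₂ (inj₁ (u-y1 a))    _         = refl
  common-neighbour-of-u-y₂ (inj₁ (u-x i a _)) (inj₁ ())
  common-neighbour-of-u-y₂ (inj₁ (u-x i a _)) (inj₂ ())
  common-neighbour-of-u-y₂ (inj₁ (u-pu b))    (inj₁ ())
  common-neighbour-of-u-y₂ (inj₁ (u-pu b))    (inj₂ ())

  neighbour-of-y₂ : ∀ {w : V ℓ k T} → Adj y2* w → cls w ≡ Cy1 ⊎ w ≡ y3*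
  neighbour-of-y₂ (inj₁ y2-y3)      = inj₂ refl
  neighbour-of-y₂ (inj₂ (y1-y2 a)) = inj₁ refl

  neighbour-of-y₃ : ∀ {w : V ℓ k T} → Adj y3* w → w ≡ y2* ⊎ cls w ≡ Cy4
  neighbour-of-y₃ (inj₁ (y3-y4 a)) = inj₂ refl
  neighbour-of-y₃ (inj₂ y2-y3)     = inj₁ refl

  neighbour-of-y₄ : ∀ {w z : V ℓ k T} → cls w ≡ Cy4 → Adj w z → z ≡ y3* ⊎ z ≡ v
  neighbour-of-y₄ {w = y4 a} refl (inj₁ (y4-v .a))  = inj₂ refl
  neighbour-of-y₄ {w = y4 a} refl (inj₂ (y3-y4 .a)) = inj₁ refl

  aut-u : (π : Automorphism ℓ k T) → Inverse.to (proj₁ π) u ≡ u → Aut-u ℓ k T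
  aut-u (π , adj) π-u = record
    { to       = Inverse.to π
    ; from     = Inverse.from π
    ; from∘to  = Inverse.strictlyInverseʳ π
    ; to∘from  = Inverse.strictlyInverseˡ π
    ; to-adj   = λ {y} {z} → Equivalence.to (adj y z)
    ; from-adj = λ {y} {z} a → Equivalence.from (adj (Inverse.from π y) (Inverse.from π z))
        (subst₂ Adj (sym (Inverse.strictlyInverseˡ π y)) (sym (Inverse.strictlyInverseˡ π z)) a)
    ; to-u     = π-u
    }

  inverse : Aut-u ℓ k T → Aut-u ℓ k T
  inverse A = record
    { to = from A ; from = to A ; from∘to = to∘from A ; to∘from = from∘to A
    ; to-adj = from-adj A ; from-adj = to-adj A
    ; to-u = trans (cong (from A) (sym (to-u A))) (from∘to A u) }

  to-injective : (A : Aut-u ℓ k T) → ∀ {y z} → to A y ≡ to A z → y ≡ z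
  to-injective A {y} {z} e = begin
    y               ≡⟨ sym (from∘to A y) ⟩
    from A (to A y) ≡⟨ cong (from A) e ⟩
    from A (to A z) ≡⟨ from∘to A z ⟩
    z               ∎
    where open ≡-Reasoning

  fixed-preimage : (A : Aut-u ℓ k T) → ∀ {p w} → to A p ≡ p → to A w ≡ p → w ≡ p
  fixed-preimage A p-fixed e = to-injective A (trans e (sym p-fixed))

  neighbour-image : (A : Aut-u ℓ k T) → ∀ {p q w} → to A p ≡ q → Adj p w → Adj q (to A w)
  neighbour-image A {w = w} e a = subst (λ q → Adj q (to A w)) e (to-adj A a)

  two-common-neighbours-image : (A : Aut-u ℓ k T) → ∀ {p q} →
    TwoCommonNeighbours p q → TwoCommonNeighbours (to A p) (to A q)
  two-common-neighbours-image A (w₁ , w₂ , w₁≢w₂ , pw₁ , w₁q , pw₂ , w₂q) =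
    to A w₁ , to A w₂ , (λ e → w₁≢w₂ (to-injective A e)) ,
    to-adj A pw₁ , to-adj A w₁q , to-adj A pw₂ , to-adj A w₂q

  Invariant : ClassLabel ℓ → Set
  Invariant c = ∀ (A : Aut-u ℓ k T) w → cls w ≡ c → cls (to A w) ≡ c

  invariant-reflects : ∀ {c} → Invariant c → ∀ A w → cls (to A w) ≡ c → cls w ≡ c
  invariant-reflects inv A w h = trans (cong cls (sym (from∘to A w))) (inv (inverse A) (to A w) h)

  module Rigidity (1<ℓ : 1 < ℓ) (a₀ a₁ : Fin k) (a₀≢a₁ : a₀ ≢ a₁) where

    y₁-paths : TwoCommonNeighbours u y2*
    y₁-paths = y1 a₀ , y1 a₁ , (λ { refl → a₀≢a₁ refl }) ,
               inj₁ (u-y1 a₀) , inj₁ (y1-y2 a₀) , inj₁ (u-y1 a₁) , inj₁ (y1-y2 a₁)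

    y₂-fixed : ∀ (A : Aut-u ℓ k T) → to A y2* ≡ y2*
    y₂-fixed A with two-common-neighbours-with-u 1<ℓ
      (subst (λ p → TwoCommonNeighbours p (to A y2*)) (to-u A)
        (two-common-neighbours-image A y₁-paths))
    ... | inj₁ e with () ← fixed-preimage A (to-u A) e
    ... | inj₂ e = e

    y₁-invariant : Invariant Cy1
    y₁-invariant A (y1 a) refl = common-neighbour-of-u-y₂
      (neighbour-image A (to-u A) (inj₁ (u-y1 a)))
      (neighbour-image A (y₂-fixed A) (inj₂ (y1-y2 a)))

    y₃-fixed : ∀ (A : Aut-u ℓ k T) → to A y3* ≡ y3*
    y₃-fixed A with neighbour-of-y₂ (neighbour-image A (y₂-fixed A) (inj₁ y2-y3))
    ... | inj₁ h with () ← invariant-reflects y₁-invariant A y3* h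
    ... | inj₂ e = e

    y₄-invariant : Invariant Cy4
    y₄-invariant A (y4 a) refl
      with neighbour-of-y₃ (neighbour-image A (y₃-fixed A) (inj₁ (y3-y4 a)))
    ... | inj₁ e with () ← fixed-preimage A (y₂-fixed A) e
    ... | inj₂ h = h

    v-fixed : ∀ (A : Aut-u ℓ k T) → to A v ≡ v
    v-fixed A with neighbour-of-y₄ (y₄-invariant A (y4 a₀) refl) (to-adj A (inj₁ (y4-v a₀)))
    ... | inj₁ e with () ← fixed-preimage A (y₃-fixed A) e
    ... | inj₂ e = e

    edge-to-second-x : ∀ {i} → toℕ i ≡ 0 → (a : Fin k) → E {T = T} (x i a) (x (fromℕ< 1<ℓ) a)
    edge-to-second-x {i} i≡0 a =
      x-x i (fromℕ< 1<ℓ) a (trans (toℕ-fromℕ< 1<ℓ) (cong suc (sym i≡0)))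

    first-x-invariant : ∀ {i} → toℕ i ≡ 0 → Invariant (Cx i)
    first-x-invariant {i} i≡0 A (x .i a) refl
      with neighbour-of-u (neighbour-image A (to-u A) (inj₁ (u-x i a i≡0)))
    ... | first-x j≡0 h = trans h (cong Cx (toℕ-injective (trans j≡0 (sym i≡0))))
    ... | first-y h with () ← invariant-reflects y₁-invariant A (x i a) h
    ... | pendant h with () ← fixed-preimage A (to-u A)
                                (neighbour-of-pendant h (to-adj A (inj₁ (edge-to-second-x i≡0 a))))

    next-x-invariant : ∀ {i i₀} → toℕ i ≡ suc (toℕ i₀) →
                       (∀ {j} → j Fin.< i → Invariant (Cx j)) → Invariant (Cx i)
    next-x-invariant {i} {i₀} i≡i₀+1 below A (x .i a) refl
      with neighbour-of-x (below (successor⇒> i≡i₀+1) A (x i₀ a) refl)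
                          (to-adj A (inj₁ (x-x i₀ i a i≡i₀+1)))
    ... | next j≡i₀+1 h = trans h (cong Cx (toℕ-injective (trans j≡i₀+1 (sym i≡i₀+1))))
    -- Reflecting through the inverse forces j = i, so i and i₀ would be each other's successor.
    ... | prev i₀≡j+1 h
      with refl ← invariant-reflects (below (<-trans (successor⇒> i₀≡j+1) (successor⇒> i≡i₀+1)))
                                     A (x i a) h
      = ⊥-elim (<-asym (successor⇒> i≡i₀+1) (successor⇒> i₀≡j+1))
    ... | is-u e with () ← fixed-preimage A (to-u A) e
    ... | is-v e with () ← fixed-preimage A (v-fixed A) e

    x-invariant : ∀ i → Invariant (Cx i)
    x-invariant = All.wfRec <-wellFounded _ (λ i → Invariant (Cx i)) step
      where
        step : ∀ i → (∀ {j} → j Fin.< i → Invariant (Cx j)) → Invariant (Cx i)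
        step i below with zero-or-successor i
        ... | inj₁ i≡0          = first-x-invariant i≡0
        ... | inj₂ (_ , i≡i₀+1) = next-x-invariant i≡i₀+1 below

    pu-invariant : Invariant Cpu
    pu-invariant A (pu b) refl with neighbour-of-u (neighbour-image A (to-u A) (inj₁ (u-pu b)))
    ... | pendant h   = h
    ... | first-x _ h with () ← invariant-reflects (x-invariant _) A (pu b) h
    ... | first-y h   with () ← invariant-reflects y₁-invariant A (pu b) h

    pv-invariant : Invariant Cpv
    pv-invariant A (pv b) refl with neighbour-of-v (neighbour-image A (v-fixed A) (inj₁ (v-pv b)))
    ... | pendant h  = h
    ... | last-x h   with () ← invariant-reflects (x-invariant _) A (pv b) h
    ... | last-y h   with () ← invariant-reflects y₄-invariant A (pv b) h

    class-invariant : ∀ c → Invariant c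
    class-invariant Cpu    = pu-invariant
    class-invariant Cu     A u refl   = cong cls (to-u A)
    class-invariant Cy1    = y₁-invariant
    class-invariant Cy2    A y2* refl = cong cls (y₂-fixed A)
    class-invariant Cy3    A y3* refl = cong cls (y₃-fixed A)
    class-invariant Cy4    = y₄-invariant
    class-invariant Cv     A v refl   = cong cls (v-fixed A)
    class-invariant Cpv    = pv-invariant
    class-invariant (Cx i) = x-invariant i

    sim⇒same-class : ∀ {y z} → Sim-u ℓ k T y z → cls y ≡ cls z
    sim⇒same-class {y} (π , π-u , πy≡z) =
      trans (sym (class-invariant (cls y) (aut-u π π-u) y refl)) (cong cls πy≡z)

  automorphism : (f g : V ℓ k T → V ℓ k T) → (∀ y → f (g y) ≡ y) → (∀ y → g (f y) ≡ y) →
                 (∀ {y z} → Adj y z → Adj (f y) (f z)) →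
                 (∀ {y z} → Adj y z → Adj (g y) (g z)) → Automorphism ℓ k T
  automorphism f g f∘g g∘f f-adj g-adj =
    mk↔ₛ′ f g f∘g g∘f , λ y z → mk⇔ f-adj λ a → subst₂ Adj (g∘f y) (g∘f z) (g-adj a)

  relabel : Permutation′ k → Permutation′ T → V ℓ k T → V ℓ k T
  relabel σ ρ u       = u
  relabel σ ρ v       = v
  relabel σ ρ y2*     = y2*
  relabel σ ρ y3*     = y3*
  relabel σ ρ (x i a) = x i (σ ⟨$⟩ʳ a)
  relabel σ ρ (y1 a)  = y1 (σ ⟨$⟩ʳ a)
  relabel σ ρ (y4 a)  = y4 (σ ⟨$⟩ʳ a)
  relabel σ ρ (pu b)  = pu (ρ ⟨$⟩ʳ b)
  relabel σ ρ (pv b)  = pv (ρ ⟨$⟩ʳ b)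

  relabel-edge : ∀ σ ρ {y z} → E y z → E (relabel σ ρ y) (relabel σ ρ z)
  relabel-edge σ ρ (u-x i a e)   = u-x i (σ ⟨$⟩ʳ a) e
  relabel-edge σ ρ (x-x i j a e) = x-x i j (σ ⟨$⟩ʳ a) e
  relabel-edge σ ρ (x-v i a e)   = x-v i (σ ⟨$⟩ʳ a) e
  relabel-edge σ ρ (u-y1 a)      = u-y1 (σ ⟨$⟩ʳ a)
  relabel-edge σ ρ (y1-y2 a)     = y1-y2 (σ ⟨$⟩ʳ a)
  relabel-edge σ ρ y2-y3         = y2-y3
  relabel-edge σ ρ (y3-y4 a)     = y3-y4 (σ ⟨$⟩ʳ a)
  relabel-edge σ ρ (y4-v a)      = y4-v (σ ⟨$⟩ʳ a)
  relabel-edge σ ρ (u-pu b)      = u-pu (ρ ⟨$⟩ʳ b)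
  relabel-edge σ ρ (v-pv b)      = v-pv (ρ ⟨$⟩ʳ b)

  relabel-adj : ∀ σ ρ {y z} → Adj y z → Adj (relabel σ ρ y) (relabel σ ρ z)
  relabel-adj σ ρ (inj₁ e) = inj₁ (relabel-edge σ ρ e)
  relabel-adj σ ρ (inj₂ e) = inj₂ (relabel-edge σ ρ e)

  relabel-flip : ∀ σ ρ y → relabel (flip σ) (flip ρ) (relabel σ ρ y) ≡ y
  relabel-flip σ ρ u       = refl
  relabel-flip σ ρ v       = refl
  relabel-flip σ ρ y2*     = refl
  relabel-flip σ ρ y3*     = refl
  relabel-flip σ ρ (x i a) = cong (x i) (inverseˡ σ)
  relabel-flip σ ρ (y1 a)  = cong y1 (inverseˡ σ)
  relabel-flip σ ρ (y4 a)  = cong y4 (inverseˡ σ)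
  relabel-flip σ ρ (pu b)  = cong pu (inverseˡ ρ)
  relabel-flip σ ρ (pv b)  = cong pv (inverseˡ ρ)

  relabel-automorphism : Permutation′ k → Permutation′ T → Automorphism ℓ k T
  relabel-automorphism σ ρ = automorphism (relabel σ ρ) (relabel (flip σ) (flip ρ))
    (relabel-flip (flip σ) (flip ρ)) (relabel-flip σ ρ)
    (relabel-adj σ ρ) (relabel-adj (flip σ) (flip ρ))

  sim-by-relabel : ∀ σ ρ {y z} → relabel σ ρ y ≡ z → Sim-u ℓ k T y z
  sim-by-relabel σ ρ e = relabel-automorphism σ ρ , refl , e

  same-class⇒sim : ∀ {y z} → cls y ≡ cls z → Sim-u ℓ k T y z
  same-class⇒sim {u}     {u}      refl = sim-by-relabel id id refl
  same-class⇒sim {v}     {v}      refl = sim-by-relabel id id refl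
  same-class⇒sim {y2*}   {y2*}    refl = sim-by-relabel id id refl
  same-class⇒sim {y3*}   {y3*}    refl = sim-by-relabel id id refl
  same-class⇒sim {x i a} {x .i b} refl = sim-by-relabel (transpose a b) id (cong (x i) (transpose-sends a b))
  same-class⇒sim {y1 a}  {y1 b}   refl = sim-by-relabel (transpose a b) id (cong y1 (transpose-sends a b))
  same-class⇒sim {y4 a}  {y4 b}   refl = sim-by-relabel (transpose a b) id (cong y4 (transpose-sends a b))
  same-class⇒sim {pu a}  {pu b}   refl = sim-by-relabel id (transpose a b) (cong pu (transpose-sends a b))
  same-class⇒sim {pv a}  {pv b}   refl = sim-by-relabel id (transpose a b) (cong pv (transpose-sends a b))

proposition18 : (ℓ k T : ℕ) → 6 < ℓ → 2 < k →
    ∀ (y z : V ℓ k T) → Sim-u ℓ k T y z ⇔ (cls y ≡ cls z)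
proposition18 ℓ (suc (suc k)) T 6<ℓ (s≤s (s≤s (s≤s _))) y z =
  mk⇔ (Rigidity.sim⇒same-class 1<ℓ Fin.zero (Fin.suc Fin.zero) (λ ())) same-class⇒sim
  where
    1<ℓ : 1 < ℓ
    1<ℓ = <-trans (s≤s (s≤s z≤n)) 6<ℓ
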